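{- Let $G$ be a connected graph with a proper coloring using colors from a set of $3$ colors, let $x$ be a vertex of eccentricity $D=\operatorname{diam}(G)$, let $L_j$ ($0\le j\le D$) be the set of vertices at distance $j$ from $x$, let $S_j$ be the set of colors used on $L_j$ and $c(j)=|S_j|$, and suppose that for each $i$ with $0\le i\le D-1$ the following hold (with $k=3$): (i) if $c(i)=1$ then $c(i+1)\le k-1$; (ii) $|S_i\cup S_{i+1}|=\min(k,c(i)+c(i+1))$; (iii) if $c(i)=k$ then $i\ge 2$ and $c(i+1)\ge 2$; (iv) if $|L_i|>c(i)$ then $i>0$ and $c(i)+\max(c(i-1),c(i+1))\ge k$. Then for every $0\le i\le D-1$, for some labeling $X,Y,Z$ of the three colors, the pair $(S_i,S_{i+1})$ is one of \[(\{X\},\{Y\}),\ (\{X\},\{Y,Z\}),\ (\{Y,Z\},\{X\}),\ (\{X,Y\},\{X,Z\}),\ (\{X,Y\},\{X,Y,Z\}),\ (\{X,Y,Z\},\{X,Y\}),\ (\{X,Y,Z\},\{X,Y,Z\}).\]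
   Context: The paper phrases this as: in the canonical clump graph of a 3-colored connected graph, only the listed color sets can occur in two consecutive layers. Here "canonical" means exactly that the layering of the colored graph satisfies conditions (i)–(iv) stated in the claim. -}

module Defs where

open import Data.Nat using (ℕ; zero; suc; _<_; _≤_)
open import Data.Fin using (Fin)
open import Data.Product using (_×_; ∃)
open import Relation.Nullary using (¬_)
open import Relation.Binary.PropositionalEquality using (_≡_; _≢_)

record Graph (n : ℕ) : Set₁ where
  field
    Adj    : Fin n → Fin n → Set
    sym    : ∀ {u v} → Adj u v → Adj v u
    irrefl : ∀ {u} → ¬ Adj u u
open Graph public

data Walk {n : ℕ} (G : Graph n) : Fin n → Fin n → ℕ → Set where
  nil  : ∀ {u} → Walk G u u 0
  cons : ∀ {u w v k} → Adj G u w → Walk G w v k → Walk G u v (suc k)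

Dist : ∀ {n} → Graph n → Fin n → Fin n → ℕ → Set
Dist G u v d = Walk G u v d × (∀ m → m < d → ¬ Walk G u v m)

Connected : ∀ {n} → Graph n → Set
Connected {n} G = ∀ (u v : Fin n) → ∃ (λ k → Walk G u v k)

ProperColoring : ∀ {n} → Graph n → (k : ℕ) → (Fin n → Fin k) → Set
ProperColoring G k col = ∀ {u v} → Adj G u v → col u ≢ col v

-- Every layer L j with j ≤ D is nonempty, because a shortest walk from x to a vertex
-- at distance D passes through each of them; so all colour sets S j are nonempty.
-- Conditions (ii) and (iii), together with (i) and nonemptiness, then leave exactly the
-- listed pairs of subsets of a 3-element colour set, which is a finite check over the
-- 64 pairs.
module Submission where

open import Defs hiding (sym)
open import Data.Nat using (ℕ; zero; suc; pred; _<_; _≤_; _+_; _∸_; _⊓_; _⊔_; _≤?_)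
open import Data.Nat.Properties using (<-cmp; +-monoˡ-<; m+[n∸m]≡n; <⇒≤)
import Data.Nat.Properties as ℕ
open import Data.Fin using (Fin)
open import Data.Fin.Properties using (any?)
import Data.Fin.Properties as Fin
import Data.Bool.Properties as Bool
open import Data.Fin.Subset using (Subset; outside; inside; _∈_; _∪_; ⁅_⁆; ∣_∣)
open import Data.Fin.Subset.Properties using (p⊆q⇒∣p∣≤∣q∣; x∈⁅y⁆⇒x≡y; ∣⁅x⁆∣≡1)
open import Data.Vec using (_∷_; [])
open import Data.Vec.Properties using (≡-dec)
open import Data.Product using (Σ; ∃; _×_; _,_; proj₂; map₂)
open import Data.Sum using (_⊎_)
open import Function.Bundles using (_⇔_; Equivalence)
open import Relation.Binary using (tri<; tri≈; tri>)
open import Relation.Nullary using (Dec; ¬?; contradiction)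
open import Relation.Nullary.Decidable using (_×-dec_; _⊎-dec_; _→-dec_; map′; from-yes)
open import Relation.Binary.PropositionalEquality using (_≡_; _≢_; refl; sym; subst)

module _ {n} {G : Graph n} where

  walk-++ : ∀ {u w v a b} → Walk G u w a → Walk G w v b → Walk G u v (a + b)
  walk-++ nil       q = q
  walk-++ (cons e p) q = cons e (walk-++ p q)

  walk-splitAt : ∀ {u v} j {m} → Walk G u v (j + m) → ∃ λ w → Walk G u w j × Walk G w v m
  walk-splitAt zero    p          = _ , nil , p
  walk-splitAt (suc j) (cons e p) with walk-splitAt j p
  ... | w , p₁ , p₂ = w , cons e p₁ , p₂

  -- The vertex reached after j steps of a shortest walk is at distance exactly j:
  -- a shorter route to it would shorten the whole walk.
  Dist-attained-below : ∀ {x v D} → (∀ w → ∃ λ d → Dist G x w d) →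
                        Dist G x v D → ∀ j → j ≤ D → ∃ λ w → Dist G x w j
  Dist-attained-below {x} {v} {D} dist (p , p-shortest) j j≤D
    with walk-splitAt j (subst (Walk G x v) (sym (m+[n∸m]≡n j≤D)) p)
  ... | w , p₁ , p₂ with dist w
  ... | d , q , q-shortest with <-cmp d j
  ... | tri< d<j _ _ = contradiction (walk-++ q p₂) (p-shortest (d + (D ∸ j)) shorter)
    where
    shorter : d + (D ∸ j) < D
    shorter = subst (d + (D ∸ j) <_) (m+[n∸m]≡n j≤D) (+-monoˡ-< (D ∸ j) d<j)
  ... | tri≈ _ refl _ = w , q , q-shortest
  ... | tri> _ _ j<d = contradiction p₁ (q-shortest j j<d)

x∈p⇒1≤∣p∣ : ∀ {m} {x : Fin m} (p : Subset m) → x ∈ p → 1 ≤ ∣ p ∣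
x∈p⇒1≤∣p∣ {x = x} p x∈p = subst (_≤ ∣ p ∣) (∣⁅x⁆∣≡1 x)
  (p⊆q⇒∣p∣≤∣q∣ λ y∈⁅x⁆ → subst (_∈ p) (sym (x∈⁅y⁆⇒x≡y x y∈⁅x⁆)) x∈p)

AdmissiblePair : Subset 3 → Subset 3 → Set
AdmissiblePair s t =
  1 ≤ ∣ s ∣ × 1 ≤ ∣ t ∣ × (∣ s ∣ ≡ 1 → ∣ t ∣ ≤ 2) ×
  ∣ s ∪ t ∣ ≡ 3 ⊓ (∣ s ∣ + ∣ t ∣) × (∣ s ∣ ≡ 3 → 2 ≤ ∣ t ∣)

ConsecutiveLayerColours : Subset 3 → Subset 3 → Set
ConsecutiveLayerColours s t = ∃ λ (X : Fin 3) → ∃ λ (Y : Fin 3) → ∃ λ (Z : Fin 3) →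
  X ≢ Y × Y ≢ Z × X ≢ Z ×
  ( (s ≡ ⁅ X ⁆ × t ≡ ⁅ Y ⁆)
  ⊎ (s ≡ ⁅ X ⁆ × t ≡ ⁅ Y ⁆ ∪ ⁅ Z ⁆)
  ⊎ (s ≡ ⁅ Y ⁆ ∪ ⁅ Z ⁆ × t ≡ ⁅ X ⁆)
  ⊎ (s ≡ ⁅ X ⁆ ∪ ⁅ Y ⁆ × t ≡ ⁅ X ⁆ ∪ ⁅ Z ⁆)
  ⊎ (s ≡ ⁅ X ⁆ ∪ ⁅ Y ⁆ × t ≡ ⁅ X ⁆ ∪ ⁅ Y ⁆ ∪ ⁅ Z ⁆)
  ⊎ (s ≡ ⁅ X ⁆ ∪ ⁅ Y ⁆ ∪ ⁅ Z ⁆ × t ≡ ⁅ X ⁆ ∪ ⁅ Y ⁆)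
  ⊎ (s ≡ ⁅ X ⁆ ∪ ⁅ Y ⁆ ∪ ⁅ Z ⁆ × t ≡ ⁅ X ⁆ ∪ ⁅ Y ⁆ ∪ ⁅ Z ⁆))

allSubsets? : ∀ {m} {P : Subset m → Set} → (∀ p → Dec (P p)) → Dec (∀ p → P p)
allSubsets? {zero}  P? = map′ (λ { P[] [] → P[] }) (λ ∀P → ∀P []) (P? [])
allSubsets? {suc m} P? =
  map′ (λ { (P-out , P-in) (outside ∷ p) → P-out p ; (P-out , P-in) (inside ∷ p) → P-in p })
       (λ ∀P → (λ p → ∀P (outside ∷ p)) , (λ p → ∀P (inside ∷ p)))
       (allSubsets? (λ p → P? (outside ∷ p)) ×-dec allSubsets? (λ p → P? (inside ∷ p)))

infix 4 _≟ₛ_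
_≟ₛ_ : (s t : Subset 3) → Dec (s ≡ t)
_≟ₛ_ = ≡-dec Bool._≟_

admissible? : ∀ s t → Dec (AdmissiblePair s t)
admissible? s t =
  1 ≤? ∣ s ∣ ×-dec 1 ≤? ∣ t ∣ ×-dec (∣ s ∣ ℕ.≟ 1 →-dec ∣ t ∣ ≤? 2) ×-dec
  ∣ s ∪ t ∣ ℕ.≟ 3 ⊓ (∣ s ∣ + ∣ t ∣) ×-dec (∣ s ∣ ℕ.≟ 3 →-dec 2 ≤? ∣ t ∣)

consecutiveLayerColours? : ∀ s t → Dec (ConsecutiveLayerColours s t)
consecutiveLayerColours? s t = any? λ X → any? λ Y → any? λ Z →
  ¬? (X Fin.≟ Y) ×-dec ¬? (Y Fin.≟ Z) ×-dec ¬? (X Fin.≟ Z) ×-dec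
  ( (s ≟ₛ ⁅ X ⁆ ×-dec t ≟ₛ ⁅ Y ⁆)
  ⊎-dec (s ≟ₛ ⁅ X ⁆ ×-dec t ≟ₛ ⁅ Y ⁆ ∪ ⁅ Z ⁆)
  ⊎-dec (s ≟ₛ ⁅ Y ⁆ ∪ ⁅ Z ⁆ ×-dec t ≟ₛ ⁅ X ⁆)
  ⊎-dec (s ≟ₛ ⁅ X ⁆ ∪ ⁅ Y ⁆ ×-dec t ≟ₛ ⁅ X ⁆ ∪ ⁅ Z ⁆)
  ⊎-dec (s ≟ₛ ⁅ X ⁆ ∪ ⁅ Y ⁆ ×-dec t ≟ₛ ⁅ X ⁆ ∪ ⁅ Y ⁆ ∪ ⁅ Z ⁆)
  ⊎-dec (s ≟ₛ ⁅ X ⁆ ∪ ⁅ Y ⁆ ∪ ⁅ Z ⁆ ×-dec t ≟ₛ ⁅ X ⁆ ∪ ⁅ Y ⁆)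
  ⊎-dec (s ≟ₛ ⁅ X ⁆ ∪ ⁅ Y ⁆ ∪ ⁅ Z ⁆ ×-dec t ≟ₛ ⁅ X ⁆ ∪ ⁅ Y ⁆ ∪ ⁅ Z ⁆))

admissible⇒consecutiveLayerColours : ∀ s t → AdmissiblePair s t → ConsecutiveLayerColours s t
admissible⇒consecutiveLayerColours = from-yes
  (allSubsets? λ s → allSubsets? λ t → admissible? s t →-dec consecutiveLayerColours? s t)

corollary4p3 :
    ∀ {n} (G : Graph n) → Connected G →
    (col : Fin n → Fin 3) → ProperColoring G 3 col →
    (x : Fin n) (D : ℕ) →
    (∀ v → Σ ℕ (λ d → d ≤ D × Dist G x v d)) →
    (∃ λ v → Dist G x v D) →
    (∀ u v d → Dist G u v d → d ≤ D) →
    (L : ℕ → Subset n) → (∀ j v → (v ∈ L j) ⇔ Dist G x v j) →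
    (S : ℕ → Subset 3) →
    (∀ j a → (a ∈ S j) ⇔ (∃ λ v → Dist G x v j × col v ≡ a)) →
    (∀ i → i < D → ∣ S i ∣ ≡ 1 → ∣ S (suc i) ∣ ≤ 2) →
    (∀ i → i < D → ∣ S i ∪ S (suc i) ∣ ≡ 3 ⊓ (∣ S i ∣ + ∣ S (suc i) ∣)) →
    (∀ i → i < D → ∣ S i ∣ ≡ 3 → 2 ≤ i × 2 ≤ ∣ S (suc i) ∣) →
    (∀ i → i < D → ∣ S i ∣ < ∣ L i ∣ →
      0 < i × 3 ≤ ∣ S i ∣ + (∣ S (pred i) ∣ ⊔ ∣ S (suc i) ∣)) →
    ∀ i → i < D →
    ∃ λ (X : Fin 3) → ∃ λ (Y : Fin 3) → ∃ λ (Z : Fin 3) →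
      X ≢ Y × Y ≢ Z × X ≢ Z ×
      ( (S i ≡ ⁅ X ⁆ × S (suc i) ≡ ⁅ Y ⁆)
      ⊎ (S i ≡ ⁅ X ⁆ × S (suc i) ≡ ⁅ Y ⁆ ∪ ⁅ Z ⁆)
      ⊎ (S i ≡ ⁅ Y ⁆ ∪ ⁅ Z ⁆ × S (suc i) ≡ ⁅ X ⁆)
      ⊎ (S i ≡ ⁅ X ⁆ ∪ ⁅ Y ⁆ × S (suc i) ≡ ⁅ X ⁆ ∪ ⁅ Z ⁆)
      ⊎ (S i ≡ ⁅ X ⁆ ∪ ⁅ Y ⁆ × S (suc i) ≡ ⁅ X ⁆ ∪ ⁅ Y ⁆ ∪ ⁅ Z ⁆)
      ⊎ (S i ≡ ⁅ X ⁆ ∪ ⁅ Y ⁆ ∪ ⁅ Z ⁆ × S (suc i) ≡ ⁅ X ⁆ ∪ ⁅ Y ⁆)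
      ⊎ (S i ≡ ⁅ X ⁆ ∪ ⁅ Y ⁆ ∪ ⁅ Z ⁆ × S (suc i) ≡ ⁅ X ⁆ ∪ ⁅ Y ⁆ ∪ ⁅ Z ⁆))
corollary4p3 G _ col _ x D ecc (_ , x-to-far) _ _ _ S S-colours cond-i cond-ii cond-iii _ i i<D =
  admissible⇒consecutiveLayerColours (S i) (S (suc i))
    ( colours-nonempty (<⇒≤ i<D) , colours-nonempty i<D
    , cond-i i i<D , cond-ii i i<D , (λ ∣Sᵢ∣≡3 → proj₂ (cond-iii i i<D ∣Sᵢ∣≡3)) )
  where
  colours-nonempty : ∀ {j} → j ≤ D → 1 ≤ ∣ S j ∣
  colours-nonempty {j} j≤D with Dist-attained-below (λ w → map₂ proj₂ (ecc w)) x-to-far j j≤D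
  ... | w , x-to-w = x∈p⇒1≤∣p∣ (S j) (Equivalence.from (S-colours j (col w)) (w , x-to-w , refl))
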